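{- Let $\mu,\nu$ be compositions. If $\kappa$ is a sorted stable configuration for $\widehat G_{\mu,\nu}$, then $\widetilde\kappa$ is a sorted stable configuration for $\widehat G_{\mu\sqcup\nu,\varnothing}$. Moreover, if $\kappa$ is recurrent for $\widehat G_{\mu,\nu}$, then $\widetilde\kappa$ is recurrent for $\widehat G_{\mu\sqcup\nu,\varnothing}$, and in this case the output word of the toppling algorithm applied to $\kappa$ on $\widehat G_{\mu,\nu}$ equals the output word of the toppling algorithm applied to $\widetilde\kappa$ on $\widehat G_{\mu\sqcup\nu,\varnothing}$.
   Context: The graph $\widehat G_{\mu,\nu}$: let $\mu,\nu$ be compositions, $n=\lvert\mu\rvert+\lvert\nu\rvert$. The vertex set $[n]$ is partitioned into clique components $K_{\mu_1}=\{n,\dots,n-\mu_1+1\}$, $K_{\mu_2}=\{n-\mu_1,\dots,n-\mu_1-\mu_2+1\}$, etc., and independent components $I_{\nu_1}=\{1,\dots,\nu_1\}$, $I_{\nu_2}=\{\nu_1+1,\dots,\nu_1+\nu_2\}$, etc. Distinct vertices are adjacent iff they lie in different components or in the same clique component. $\widehat G_{\mu,\nu}$ adds a sink $0$ adjacent to all of $[n]$. The graph $\widehat G_{\mu\sqcup\nu,\varnothing}$ is obtained from $\widehat G_{\mu,\nu}$ by adding all missing edges inside each $I_{\nu_r}$ (so it is the complete graph on $\{0\}\cup[n]$), keeping the same names $K_{\mu_s}$, $I_{\nu_r}$ for the components. Sandpile model: configurations are maps $\kappa:[n]\to\mathbb Z$; a non-sink vertex $v$ is stable if $\kappa(v)<\deg(v)$,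 unstable otherwise; toppling $v$ subtracts $\deg(v)$ at $v$ and adds $1$ at each neighbour. A stable $\kappa$ is recurrent if for some ordering $\sigma(1),\dots,\sigma(n)$ of $[n]$, after toppling the sink and then toppling $\sigma(1),\dots,\sigma(n)$ in this order, all intermediate configurations are non-negative on $[n]$. Toppling algorithm for a recurrent $\kappa$: topple the sink; then while some non-sink vertex is untoppled, for $i=n,n-1,\dots,1$: if $i$ is unstable, topple it and append $i$ to the output word. A configuration of $\widehat G_{\mu,\nu}$ is sorted if it is weakly decreasing on each clique component ($i<j$ in $K_{\mu_s}$ implies $\kappa(i)\ge\kappa(j)$) and weakly increasing on each independent component ($i<j$ in $I_{\nu_r}$ implies $\kappa(i)\le\kappa(j)$). A configuration of $\widehat G_{\mu\sqcup\nu,\varnothing}$ is sorted if it is weakly decreasing on each $K_{\mu_s}$ and weakly increasing on each $I_{\nu_r}$. Given a configuration $\kappa$ of $\widehat G_{\mu,\nu}$, define $\widetilde\kappa$ by $\widetilde\kappa(v)=\kappa(v)$ for $v$ in a clique component, and, listing the vertices of $I_{\nu_s}$ in decreasing order as $v^{(s)}_1>v^{(s)}_2>\cdots>v^{(s)}_{\nu_s}$, $\widetilde\kappa(v^{(s)}_j)=\kappa(v^{(s)}_j)+\nu_s-j$. -}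

module Defs where

open import Data.Bool using (Bool; true; false; if_then_else_; _∧_; _∨_; not)
open import Data.Nat as ℕ using (ℕ; zero; suc; _+_; _∸_; _≡ᵇ_; _≤ᵇ_)
open import Data.Integer as ℤ using (ℤ; +_; _-_; 0ℤ)
open import Data.List using (List; []; _∷_; map; _++_; reverse; upTo; length; filter)
open import Data.Nat.ListAction using (sum)
import Data.Bool.ListAction as BL
open import Data.List.Membership.Propositional using (_∈_)
open import Data.List.Relation.Binary.Permutation.Propositional using (_↭_)
open import Data.Product using (Σ; _×_; _,_)
open import Data.Unit using (⊤)
open import Relation.Nullary.Decidable using (⌊_⌋)
open import Relation.Binary.PropositionalEquality using (_≡_)

-- The graphs  Ĝ_{μ,ν}  (fill = false)  and  Ĝ_{μ⊔ν,∅}  (fill = true),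
-- the latter with the same vertex layout and component names.
-- Non-sink vertices are the naturals 1..n; the sink 0 is treated
-- separately (it is adjacent to every non-sink vertex).

record Graph : Set where
  constructor graph
  field
    fill : Bool
    μ    : List ℕ
    ν    : List ℕ

open Graph public

Ĝ : List ℕ → List ℕ → Graph
Ĝ μ ν = graph false μ ν

-- Ĝ_{μ⊔ν,∅}, obtained from Ĝ_{μ,ν} by adding all edges inside each I_{ν_r}
Ĝ⊔ : List ℕ → List ℕ → Graph
Ĝ⊔ μ ν = graph true μ ν

IsComposition : List ℕ → Set
IsComposition [] = ⊤
IsComposition (k ∷ ks) = (1 ℕ.≤ k) × IsComposition ks

size : Graph → ℕ
size G = sum (μ G) + sum (ν G)

verts : Graph → List ℕ
verts G = map suc (upTo (size G))

-- blocks listed from vertex 1 upwards: I_{ν_1}, I_{ν_2}, …, then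
-- …, K_{μ_2}, K_{μ_1} (so K_{μ_1} = {n, …, n-μ_1+1}).
-- The Bool records whether the component is a clique component K.
blocks : Graph → List (Bool × ℕ)
blocks G = map (λ k → (false , k)) (ν G) ++ reverse (map (λ k → (true , k)) (μ G))

record Loc : Set where
  constructor loc
  field
    idx    : ℕ
    clique : Bool
    start  : ℕ
    bsize  : ℕ

open Loc public

locate : List (Bool × ℕ) → ℕ → ℕ → ℕ → Loc
locate [] base i v = loc i false 0 0
locate ((b , s) ∷ bs) base i v =
  if v ≤ᵇ base + s then loc i b (suc base) s else locate bs (base + s) (suc i) v

locOf : Graph → ℕ → Loc
locOf G v = locate (blocks G) 0 0 v

adj : Graph → ℕ → ℕ → Bool
adj G u v = not (u ≡ᵇ v) ∧
  (not (idx (locOf G u) ≡ᵇ idx (locOf G v)) ∨ clique (locOf G u) ∨ fill G)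

-- degree of a non-sink vertex (the +1 is the edge to the sink)
deg : Graph → ℕ → ℕ
deg G v = suc (length (filter (λ u → Data.Bool._≟_ (adj G u v) true) (verts G)))

Config : Set
Config = ℕ → ℤ

InRange : Graph → ℕ → Set
InRange G v = (1 ℕ.≤ v) × (v ℕ.≤ size G)

Stable : Graph → Config → Set
Stable G κ = ∀ v → InRange G v → κ v ℤ.< + deg G v

unstable? : Graph → Config → ℕ → Bool
unstable? G κ v = ⌊ (+ deg G v) ℤ.≤? κ v ⌋

toppleSink : Graph → Config → Config
toppleSink G κ u = κ u ℤ.+ + 1

topple : Graph → ℕ → Config → Config
topple G v κ u =
  if u ≡ᵇ v then κ u - + deg G v
  else (if adj G v u then κ u ℤ.+ + 1 else κ u)

NonNeg : Graph → Config → Set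
NonNeg G κ = ∀ v → InRange G v → 0ℤ ℤ.≤ κ v

LegalSeq : Graph → Config → List ℕ → Set
LegalSeq G κ [] = ⊤
LegalSeq G κ (v ∷ σ) = NonNeg G (topple G v κ) × LegalSeq G (topple G v κ) σ

Recurrent : Graph → Config → Set
Recurrent G κ = Stable G κ ×
  Σ (List ℕ) (λ σ → (σ ↭ verts G) × NonNeg G (toppleSink G κ) × LegalSeq G (toppleSink G κ) σ)

Sorted : Graph → Config → Set
Sorted G κ = ∀ i j → InRange G i → InRange G j → i ℕ.< j →
  idx (locOf G i) ≡ idx (locOf G j) →
  (clique (locOf G i) ≡ true → κ j ℤ.≤ κ i) ×
  (clique (locOf G i) ≡ false → κ i ℤ.≤ κ j)

record AState : Set where
  constructor st
  field
    conf : Config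
    word : List ℕ

open AState public

pass : Graph → List ℕ → AState → AState
pass G [] s = s
pass G (i ∷ is) (st κ w) =
  if unstable? G κ i
  then pass G is (st (topple G i κ) (w ++ (i ∷ [])))
  else pass G is (st κ w)

allToppled : Graph → List ℕ → Bool
allToppled G w = BL.all (λ v → BL.any (λ u → u ≡ᵇ v) w) (verts G)

loop : Graph → ℕ → AState → AState
loop G zero s = s
loop G (suc f) s =
  if allToppled G (word s) then s
  else loop G f (pass G (reverse (verts G)) s)

-- the output word of the toppling algorithm.  For recurrent κ every
-- pass topples at least one new vertex, so n passes suffice.
outputWord : Graph → Config → List ℕ
outputWord G κ = word (loop G (size G) (st (toppleSink G κ) []))

-- κ ↦ κ̃ : unchanged on clique components; on I_{ν_s} with vertices
-- v_1 > v_2 > … > v_{ν_s}, κ̃(v_j) = κ(v_j) + ν_s - j.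
-- For a vertex v of a block with least vertex a and size s, the
-- index j with v = v_j is  j = a + s - v.
tilde : Graph → Config → Config
tilde G κ v with locOf G v
... | loc _ true  a s = κ v
... | loc _ false a s = κ v ℤ.+ + (s ∸ (a + s ∸ v))

-- In Ĝ⊔ μ ν every vertex is adjacent to every other one, so passing from Ĝ μ ν to Ĝ⊔ μ ν only
-- affects a vertex v of an independent component: with D lower and U upper mates in its
-- component, v gains D chips in κ̃ and D + U in degree.  This transfers stability and
-- sortedness at once.  For the toppling algorithm, an induction along each pass n, …, 1 shows
-- that the toppled vertices are upward closed in each independent component, and that the
-- untoppled vertices above the scan position, in a component reaching below it, are stable.
-- An untoppled v then has no toppled lower mate, and if v is unstable in Ĝ μ ν all its upper
-- mates are toppled (an untoppled one would be stable and, by sortedness, at least as full as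
-- v).  So, against a threshold raised by D + U, v carries D extra chips plus one for each
-- toppled upper mate; both graphs make the same decision and the runs coincide.  A recurrent
-- configuration makes the algorithm topple every vertex, so the common output word also
-- witnesses the recurrence of κ̃.

module Submission where

open import Defs
open import Relation.Binary.PropositionalEquality hiding ([_])
open import Data.Bool using (Bool; true; false; if_then_else_; _∧_; _∨_; not; T)
open import Data.Bool.Properties using (∨-zeroʳ; ∧-zeroʳ; ∧-identityʳ)
import Data.Bool.ListAction as BL
open import Data.Nat as ℕ using (ℕ; zero; suc; _+_; _*_; _∸_; _≤_; _<_; z≤n; s≤s; _≡ᵇ_; _<ᵇ_; _≤ᵇ_)
open import Data.Nat.Properties as ℕₚ
  using ( +-suc; +-identityʳ; +-comm; +-assoc; *-zeroʳ; *-identityʳ; *-suc; ≡ᵇ⇒≡; ≡⇒≡ᵇ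
        ; ≤-refl; ≤-reflexive; ≤-trans; ≤-antisym; ≤-pred; <-trans; <-≤-trans; ≤-<-trans; <-irrefl; <-asym; <-cmp
        ; <⇒≤; <⇒≢; <⇒≱; ≰⇒>; ≮⇒≥; ≤⇒≯; n≤1+n; m≤m+n; m≤n⇒m≤1+n; m≤n⇒m<n∨m≡n; +-monoʳ-≤
        ; +-cancelʳ-≡; +-cancelˡ-<; ∸-monoˡ-≤; m∸n+n≡m; m+[n∸m]≡n; [m+n]∸[m+o]≡n∸o; m∸[m∸n]≡n
        ; <ᵇ-reflects-<; ≤ᵇ-reflects-≤ )
open import Data.Nat.ListAction using (sum)
open import Data.Nat.ListAction.Properties using (sum-++; sum-↭)
open import Data.Integer as ℤ using (ℤ; +_; _-_; 0ℤ)
open import Data.Integer.Properties as ℤₚ using (pos-+)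
open import Data.Integer.Tactic.RingSolver using (solve-∀)
open import Data.List using (List; []; _∷_; _++_; [_]; length; filter; map; upTo; foldl; reverse; downFrom)
open import Data.List.Properties
  using (length-map; length-upTo; upTo-∷ʳ; map-++; map-∘; map-id; foldl-∷ʳ; ++-assoc; reverse-map; reverse-upTo)
open import Data.List.Membership.Propositional using (_∈_; _∉_; find)
open import Data.List.Membership.Propositional.Properties
  using (∈-∃++; ∈-map⁺; ∈-map⁻; ∈-upTo⁺; ∈-upTo⁻; ∈-++⁺ˡ; ∈-++⁺ʳ; ∈-++⁻)
open import Data.List.Membership.Propositional.Properties.WithK using (unique∧set⇒bag)
open import Data.List.Membership.DecPropositional ℕ._≟_ using (_∈?_)
open import Data.List.Relation.Unary.All as All using (All; []; _∷_)
import Data.List.Relation.Unary.All.Properties as Allₚ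
open import Data.List.Relation.Unary.Any as Any using (Any; here; there)
open import Data.List.Relation.Unary.Any.Properties using (any⁺; any⁻; reverse⁻)
open import Data.List.Relation.Unary.Unique.Propositional using (Unique; []; _∷_)
import Data.List.Relation.Unary.Unique.Propositional.Properties as Uniqueₚ
open import Data.List.Relation.Binary.BagAndSetEquality using (∼bag⇒↭)
open import Data.List.Relation.Binary.Permutation.Propositional using (_↭_; ↭-sym; ↭⇒↭ₛ)
open import Data.List.Relation.Binary.Permutation.Propositional.Properties using (Any-resp-↭; All-resp-↭; ↭-reverse)
open import Data.List.Relation.Binary.Permutation.Setoid.Properties (setoid ℕ) using (Unique-resp-↭)
open import Data.Product using (∃-syntax; _×_; _,_; proj₁; proj₂; uncurry)
open import Data.Sum using (_⊎_; inj₁; inj₂; [_,_]′)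
open import Data.Unit using (tt)
open import Data.Empty using (⊥-elim)
open import Function.Bundles using (_⇔_; mk⇔; Equivalence)
open import Relation.Nullary using (¬_; Dec; yes; no)
open import Relation.Nullary.Reflects using (Reflects; ofʸ; ofⁿ; fromEquivalence)
open import Relation.Nullary.Decidable using (proof; dec-true; dec-false)
open import Relation.Binary using (tri<; tri≈; tri>)

private
  variable
    A : Set
    P Q : A → Bool
    x y : A
    xs ys : List A

countᵇ : (A → Bool) → List A → ℕ
countᵇ P [] = 0
countᵇ P (x ∷ xs) = if P x then suc (countᵇ P xs) else countᵇ P xs

countᵇ-++ : ∀ xs ys → countᵇ P (xs ++ ys) ≡ countᵇ P xs + countᵇ P ys
countᵇ-++ [] ys = refl
countᵇ-++ {P = P} (x ∷ xs) ys with P x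
... | true = cong suc (countᵇ-++ xs ys)
... | false = countᵇ-++ xs ys

length-filter-≡true : ∀ (P : A → Bool) xs →
  length (filter (λ u → Data.Bool._≟_ (P u) true) xs) ≡ countᵇ P xs
length-filter-≡true P [] = refl
length-filter-≡true P (x ∷ xs) with P x
... | true = cong suc (length-filter-≡true P xs)
... | false = length-filter-≡true P xs

countᵇ-cong : (∀ {x} → x ∈ xs → P x ≡ Q x) → countᵇ P xs ≡ countᵇ Q xs
countᵇ-cong {xs = []} eq = refl
countᵇ-cong {xs = x ∷ xs} {P} {Q} eq with P x | Q x | eq (here refl)
... | true | .true | refl = cong suc (countᵇ-cong (λ m → eq (there m)))
... | false | .false | refl = countᵇ-cong (λ m → eq (there m))

countᵇ-none : (∀ {x} → x ∈ xs → P x ≡ false) → countᵇ P xs ≡ 0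
countᵇ-none {xs = []} h = refl
countᵇ-none {xs = x ∷ xs} h rewrite h (here refl) = countᵇ-none (λ m → h (there m))

countᵇ-all : (∀ {x} → x ∈ xs → P x ≡ true) → countᵇ P xs ≡ length xs
countᵇ-all {xs = []} h = refl
countᵇ-all {xs = x ∷ xs} h rewrite h (here refl) = cong suc (countᵇ-all (λ m → h (there m)))

countᵇ-∨ : (∀ {x} → x ∈ xs → (P x ∧ Q x) ≡ false) →
  countᵇ (λ x → P x ∨ Q x) xs ≡ countᵇ P xs + countᵇ Q xs
countᵇ-∨ {xs = []} h = refl
countᵇ-∨ {xs = x ∷ xs} {P} {Q} h with P x | Q x | h (here refl)
... | true  | false | _ = cong suc (countᵇ-∨ (λ m → h (there m)))
... | false | true  | _ = trans (cong suc (countᵇ-∨ (λ m → h (there m)))) (sym (+-suc _ _))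
... | false | false | _ = countᵇ-∨ (λ m → h (there m))

private
  ∈-delete : ∀ ys → x ∈ ys ++ y ∷ xs → x ≢ y → x ∈ ys ++ xs
  ∈-delete [] (here refl) x≢y = ⊥-elim (x≢y refl)
  ∈-delete [] (there m) _ = m
  ∈-delete (z ∷ ys) (here refl) _ = here refl
  ∈-delete (z ∷ ys) (there m) x≢y = there (∈-delete ys m x≢y)

  countᵇ-delete : ∀ ys → P y ≡ true → countᵇ P (ys ++ y ∷ xs) ≡ suc (countᵇ P (ys ++ xs))
  countᵇ-delete [] Py rewrite Py = refl
  countᵇ-delete {P = P} (z ∷ ys) Py with P z
  ... | true = cong suc (countᵇ-delete ys Py)
  ... | false = countᵇ-delete ys Py

countᵇ-⊆ : Unique xs → (∀ {x} → x ∈ xs → P x ≡ true → x ∈ ys) → countᵇ P xs ≤ countᵇ P ys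
countᵇ-⊆ [] _ = z≤n
countᵇ-⊆ {xs = x ∷ xs} {P} (x∉xs ∷ u) sub with P x in Px
... | false = countᵇ-⊆ u (λ m → sub (there m))
... | true with ys₁ , ys₂ , refl ← ∈-∃++ (sub (here refl) Px) =
  subst (suc (countᵇ P xs) ≤_) (sym (countᵇ-delete ys₁ Px))
    (s≤s (countᵇ-⊆ u (λ m Py → ∈-delete ys₁ (sub (there m) Py) (≢-sym (All.lookup x∉xs m)))))

length-⊆ : Unique xs → (∀ {x} → x ∈ xs → x ∈ ys) → length xs ≤ length ys
length-⊆ {xs = xs} {ys} u sub =
  subst₂ _≤_ (countᵇ-all {xs = xs} {P = λ _ → true} (λ _ → refl))
             (countᵇ-all {xs = ys} {P = λ _ → true} (λ _ → refl))
    (countᵇ-⊆ u (λ m _ → sub m))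

≡ᵇ-reflects : ∀ m n → Reflects (m ≡ n) (m ≡ᵇ n)
≡ᵇ-reflects m n = proof (m ℕ.≟ n)

≡ᵇ-refl : ∀ n → (n ≡ᵇ n) ≡ true
≡ᵇ-refl n = dec-true (n ℕ.≟ n) refl

≢⇒≡ᵇ-false : ∀ m n → m ≢ n → (m ≡ᵇ n) ≡ false
≢⇒≡ᵇ-false m n = dec-false (m ℕ.≟ n)

≢ᵇ≡<ᵇ∨>ᵇ : ∀ x v → not (x ≡ᵇ v) ≡ ((x <ᵇ v) ∨ (v <ᵇ x))
≢ᵇ≡<ᵇ∨>ᵇ x v with <-cmp x v
... | tri< x<v _ _ rewrite ≢⇒≡ᵇ-false x v (<⇒≢ x<v) | dec-true (x ℕ.<? v) x<v = refl
... | tri≈ _ refl _ rewrite ≡ᵇ-refl x | dec-false (x ℕ.<? x) (<-irrefl refl) = refl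
... | tri> _ _ v<x rewrite ≢⇒≡ᵇ-false x v (≢-sym (<⇒≢ v<x)) | dec-true (v ℕ.<? x) v<x = sym (∨-zeroʳ _)

<ᵇ∧>ᵇ≡false : ∀ x v → ((x <ᵇ v) ∧ (v <ᵇ x)) ≡ false
<ᵇ∧>ᵇ≡false x v with x <ᵇ v | <ᵇ-reflects-< x v | v <ᵇ x | <ᵇ-reflects-< v x
... | true  | ofʸ x<v | true | ofʸ v<x = ⊥-elim (<-asym x<v v<x)
... | true  | _       | false | _      = refl
... | false | _       | _     | _      = refl

s∸[a+s∸v]≡v∸a : ∀ {a s v} → a ≤ v → v < a + s → s ∸ (a + s ∸ v) ≡ v ∸ a
s∸[a+s∸v]≡v∸a {a} {s} {v} a≤v v<a+s = begin
  s ∸ (a + s ∸ v)             ≡⟨ cong (λ z → s ∸ (a + s ∸ z)) a+[v∸a]≡v ⟨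
  s ∸ (a + s ∸ (a + (v ∸ a))) ≡⟨ cong (s ∸_) ([m+n]∸[m+o]≡n∸o a s (v ∸ a)) ⟩
  s ∸ (s ∸ (v ∸ a))           ≡⟨ m∸[m∸n]≡n (<⇒≤ (+-cancelˡ-< a _ _ (subst (_< a + s) (sym a+[v∸a]≡v) v<a+s))) ⟩
  v ∸ a                       ∎
  where
  open ≡-Reasoning
  a+[v∸a]≡v = m+[n∸m]≡n a≤v

countᵇ-≡ᵇ-∉ : ∀ {v} {w : List ℕ} → v ∉ w → countᵇ (_≡ᵇ v) w ≡ 0
countᵇ-≡ᵇ-∉ {v} {w} v∉w = countᵇ-none {xs = w} {P = _≡ᵇ v} (λ {x} x∈w → ≢⇒≡ᵇ-false x v (λ { refl → v∉w x∈w }))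

countᵇ-≡ᵇ-unique : ∀ {v} {w : List ℕ} → Unique w → v ∈ w → countᵇ (_≡ᵇ v) w ≡ 1
countᵇ-≡ᵇ-unique {v} (v∉w ∷ _) (here refl) rewrite ≡ᵇ-refl v =
  cong suc (countᵇ-≡ᵇ-∉ (λ v∈w → All.lookup v∉w v∈w refl))
countᵇ-≡ᵇ-unique {v} {x ∷ w} (x∉w ∷ u) (there v∈w) with x ≡ᵇ v | ≡ᵇ-reflects x v
... | false | _ = countᵇ-≡ᵇ-unique u v∈w
... | true | ofʸ refl = ⊥-elim (All.lookup x∉w v∈w refl)

vertices : ℕ → List ℕ
vertices n = map suc (upTo n)

∈-vertices⁺ : ∀ {n v} → 1 ≤ v → v ≤ n → v ∈ vertices n
∈-vertices⁺ {v = suc v} _ v<n = ∈-map⁺ suc (∈-upTo⁺ v<n)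

∈-vertices⁻ : ∀ {n v} → v ∈ vertices n → 1 ≤ v × v ≤ n
∈-vertices⁻ v∈ with _ , x∈ , refl ← ∈-map⁻ suc v∈ = s≤s z≤n , ∈-upTo⁻ x∈

vertices-unique : ∀ n → Unique (vertices n)
vertices-unique n = Uniqueₚ.map⁺ ℕₚ.suc-injective (Uniqueₚ.upTo⁺ n)

length-vertices : ∀ n → length (vertices n) ≡ n
length-vertices n = trans (length-map suc (upTo n)) (length-upTo n)

vertices-suc : ∀ n → vertices (suc n) ≡ vertices n ++ [ suc n ]
vertices-suc n = trans (cong (map suc) (sym (upTo-∷ʳ n))) (map-++ suc (upTo n) [ n ])

countᵇ-<ᵇ-vertices : ∀ n b → 1 ≤ b → b ≤ suc n → countᵇ (_<ᵇ b) (vertices n) ≡ b ∸ 1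
countᵇ-<ᵇ-vertices zero (suc zero) _ _ = refl
countᵇ-<ᵇ-vertices zero (suc (suc b)) _ (s≤s ())
countᵇ-<ᵇ-vertices (suc n) b 1≤b b≤2+n = begin
  countᵇ (_<ᵇ b) (vertices (suc n))
    ≡⟨ cong (countᵇ (_<ᵇ b)) (vertices-suc n) ⟩
  countᵇ (_<ᵇ b) (vertices n ++ [ suc n ])
    ≡⟨ countᵇ-++ (vertices n) [ suc n ] ⟩
  countᵇ (_<ᵇ b) (vertices n) + countᵇ (_<ᵇ b) [ suc n ]
    ≡⟨ last (m≤n⇒m<n∨m≡n b≤2+n) ⟩
  b ∸ 1 ∎
  where
  open ≡-Reasoning
  last : b < suc (suc n) ⊎ b ≡ suc (suc n) →
         countᵇ (_<ᵇ b) (vertices n) + countᵇ (_<ᵇ b) [ suc n ] ≡ b ∸ 1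
  last (inj₁ (s≤s b≤1+n)) rewrite dec-false (suc n ℕ.<? b) (≤⇒≯ b≤1+n) =
    trans (+-identityʳ _) (countᵇ-<ᵇ-vertices n b 1≤b b≤1+n)
  last (inj₂ refl) rewrite dec-true (suc n ℕ.<? b) ≤-refl
                         | countᵇ-all {xs = vertices n} {P = _<ᵇ b}
                             (λ x∈ → dec-true (_ ℕ.<? b) (s≤s (m≤n⇒m≤1+n (proj₂ (∈-vertices⁻ x∈)))))
                         | length-vertices n = +-comm n 1

-- Toppling words

toppleWord : Graph → Config → List ℕ → Config
toppleWord G = foldl (λ κ x → topple G x κ)

neighbours : Graph → ℕ → List ℕ → ℕ
neighbours G v = countᵇ (λ x → adj G x v)

deg≡suc-neighbours : ∀ G v → deg G v ≡ suc (neighbours G v (verts G))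
deg≡suc-neighbours G v = cong suc (length-filter-≡true (λ x → adj G x v) (verts G))

topple-self : ∀ G v κ → topple G v κ v ≡ κ v - + deg G v
topple-self G v κ rewrite ≡ᵇ-refl v = refl

topple-other : ∀ G x v κ → v ≢ x → topple G x κ v ≡ (if adj G x v then κ v ℤ.+ + 1 else κ v)
topple-other G x v κ v≢x rewrite ≢⇒≡ᵇ-false v x v≢x = refl

toppleWord-∷ʳ : ∀ G c w x → toppleWord G c (w ++ [ x ]) ≡ topple G x (toppleWord G c w)
toppleWord-∷ʳ G c w x = foldl-∷ʳ (λ κ y → topple G y κ) c x w

toppleWord-value : ∀ G c w v →
  toppleWord G c w v ℤ.+ + (deg G v * countᵇ (_≡ᵇ v) w) ≡ c v ℤ.+ + neighbours G v w
toppleWord-value G c [] v = cong (λ k → c v ℤ.+ + k) (*-zeroʳ (deg G v))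
toppleWord-value G c (x ∷ w) v with v ℕ.≟ x
... | yes refl rewrite ≡ᵇ-refl v = begin
    t ℤ.+ + (d * suc C)              ≡⟨ cong (λ k → t ℤ.+ + k) (*-suc d C) ⟩
    t ℤ.+ + (d + d * C)              ≡⟨ cong (λ z → t ℤ.+ z) (pos-+ d (d * C)) ⟩
    t ℤ.+ (+ d ℤ.+ + (d * C))        ≡⟨ reorder t (+ d) (+ (d * C)) ⟩
    (t ℤ.+ + (d * C)) ℤ.+ + d        ≡⟨ cong (ℤ._+ + d) (toppleWord-value G (topple G v c) w v) ⟩
    (topple G v c v ℤ.+ + N) ℤ.+ + d ≡⟨ cong (λ z → (z ℤ.+ + N) ℤ.+ + d) (topple-self G v c) ⟩
    ((c v - + d) ℤ.+ + N) ℤ.+ + d    ≡⟨ cancel (c v) (+ d) (+ N) ⟩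
    c v ℤ.+ + N                      ∎
  where
  open ≡-Reasoning
  t = toppleWord G (topple G v c) w v
  d = deg G v
  C = countᵇ (_≡ᵇ v) w
  N = neighbours G v w
  reorder : ∀ t a b → t ℤ.+ (a ℤ.+ b) ≡ (t ℤ.+ b) ℤ.+ a
  reorder = solve-∀
  cancel : ∀ c d n → ((c - d) ℤ.+ n) ℤ.+ d ≡ c ℤ.+ n
  cancel = solve-∀
... | no v≢x = begin
    t ℤ.+ + (d * (if x ≡ᵇ v then suc C else C))         ≡⟨ cong (λ b → t ℤ.+ + (d * (if b then suc C else C)))
                                                                (≢⇒≡ᵇ-false x v (≢-sym v≢x)) ⟩
    t ℤ.+ + (d * C)                                     ≡⟨ toppleWord-value G (topple G x c) w v ⟩
    topple G x c v ℤ.+ + N                              ≡⟨ cong (ℤ._+ + N) (topple-other G x v c v≢x) ⟩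
    (if adj G x v then c v ℤ.+ + 1 else c v) ℤ.+ + N    ≡⟨ shift (adj G x v) ⟩
    c v ℤ.+ + (if adj G x v then suc N else N)          ∎
  where
  open ≡-Reasoning
  t = toppleWord G (topple G x c) w v
  d = deg G v
  C = countᵇ (_≡ᵇ v) w
  N = neighbours G v w
  shift : ∀ b → (if b then c v ℤ.+ + 1 else c v) ℤ.+ + N ≡ c v ℤ.+ + (if b then suc N else N)
  shift true = ℤₚ.+-assoc (c v) (+ 1) (+ N)
  shift false = refl

toppleWord-∉ : ∀ G c {w v} → v ∉ w → toppleWord G c w v ≡ c v ℤ.+ + neighbours G v w
toppleWord-∉ G c {w} {v} v∉w = trans (sym never-toppled) (toppleWord-value G c w v)
  where
  never-toppled : toppleWord G c w v ℤ.+ + (deg G v * countᵇ (_≡ᵇ v) w) ≡ toppleWord G c w v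
  never-toppled rewrite countᵇ-≡ᵇ-∉ v∉w | *-zeroʳ (deg G v) = ℤₚ.+-identityʳ _

toppleWord-∈ : ∀ G c {w v} → Unique w → v ∈ w →
  toppleWord G c w v ℤ.+ + deg G v ≡ c v ℤ.+ + neighbours G v w
toppleWord-∈ G c {w} {v} u v∈w =
  trans (cong (λ k → toppleWord G c w v ℤ.+ + k)
              (sym (trans (cong (deg G v *_) (countᵇ-≡ᵇ-unique u v∈w)) (*-identityʳ (deg G v)))))
        (toppleWord-value G c w v)

neighbours-< : ∀ G {w} v → Unique w → All (InRange G) w → neighbours G v w < deg G v
neighbours-< G {w} v u inRange = subst (neighbours G v w <_) (sym (deg≡suc-neighbours G v))
  (s≤s (countᵇ-⊆ u (λ x∈w _ → uncurry ∈-vertices⁺ (All.lookup inRange x∈w))))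

record VertexSet (G : Graph) (w : List ℕ) : Set where
  field
    unique  : Unique w
    inRange : All (InRange G) w

open VertexSet public

[]-VertexSet : ∀ G → VertexSet G []
[]-VertexSet G = record { unique = [] ; inRange = [] }

VertexSet-∷ʳ : ∀ {G w x} → VertexSet G w → InRange G x → x ∉ w → VertexSet G (w ++ [ x ])
VertexSet-∷ʳ vs x-inRange x∉w = record
  { unique  = Uniqueₚ.++⁺ (unique vs) ([] ∷ []) (λ { (x∈w , here refl) → x∉w x∈w })
  ; inRange = Allₚ.++⁺ (inRange vs) (x-inRange ∷ [])
  }

private
  +-cancelʳ-≤ : ∀ i j k → i ℤ.+ k ℤ.≤ j ℤ.+ k → i ℤ.≤ j
  +-cancelʳ-≤ i j k h = subst₂ ℤ._≤_ (cancel i k) (cancel j k) (ℤₚ.+-monoˡ-≤ (ℤ.- k) h)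
    where
    cancel : ∀ x y → x ℤ.+ y ℤ.+ ℤ.- y ≡ x
    cancel = solve-∀

-- Each topple of v returns deg v chips while v receives fewer than deg v from its other
-- neighbours, so v ends below its (stable) start value.
toppled-stable : ∀ G κ {w v} → Stable G κ → VertexSet G w → InRange G v → v ∈ w →
  toppleWord G (toppleSink G κ) w v ℤ.< + deg G v
toppled-stable G κ {w} {v} stable vs v-inRange v∈w =
  ℤₚ.≤-<-trans (+-cancelʳ-≤ _ _ (+ deg G v) bound) (stable v v-inRange)
  where
  open ℤₚ.≤-Reasoning
  bound : toppleWord G (toppleSink G κ) w v ℤ.+ + deg G v ℤ.≤ κ v ℤ.+ + deg G v
  bound = begin
    toppleWord G (toppleSink G κ) w v ℤ.+ + deg G v ≡⟨ toppleWord-∈ G (toppleSink G κ) (unique vs) v∈w ⟩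
    (κ v ℤ.+ + 1) ℤ.+ + neighbours G v w            ≡⟨ ℤₚ.+-assoc (κ v) (+ 1) _ ⟩
    κ v ℤ.+ + suc (neighbours G v w)                ≤⟨ ℤₚ.+-monoʳ-≤ (κ v) (ℤ.+≤+ (neighbours-< G v (unique vs) (inRange vs))) ⟩
    κ v ℤ.+ + deg G v                               ∎

unstable?-reflects : ∀ G κ v → Reflects (+ deg G v ℤ.≤ κ v) (unstable? G κ v)
unstable?-reflects G κ v with + deg G v ℤ.≤? κ v
... | yes unstable = ofʸ unstable
... | no stable = ofⁿ stable

unstable⇒untoppled : ∀ G κ {w x} → Stable G κ → VertexSet G w → InRange G x →
  + deg G x ℤ.≤ toppleWord G (toppleSink G κ) w x → x ∉ w
unstable⇒untoppled G κ stable vs x-inRange unstable x∈w =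
  ℤₚ.<⇒≱ (toppled-stable G κ stable vs x-inRange x∈w) unstable

-- The toppling algorithm

passWord : Graph → Config → List ℕ → List ℕ → List ℕ
passWord G c [] w = w
passWord G c (i ∷ is) w =
  if unstable? G (toppleWord G c w) i then passWord G c is (w ++ [ i ]) else passWord G c is w

loopWord : Graph → Config → ℕ → List ℕ → List ℕ
loopWord G c zero w = w
loopWord G c (suc f) w =
  if allToppled G w then w else loopWord G c f (passWord G c (reverse (verts G)) w)

pass-toppleWord : ∀ G c is w →
  pass G is (st (toppleWord G c w) w) ≡ st (toppleWord G c (passWord G c is w)) (passWord G c is w)
pass-toppleWord G c [] w = refl
pass-toppleWord G c (i ∷ is) w with unstable? G (toppleWord G c w) i
... | true = trans (cong (λ κ → pass G is (st κ (w ++ [ i ]))) (sym (toppleWord-∷ʳ G c w i)))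
                   (pass-toppleWord G c is (w ++ [ i ]))
... | false = pass-toppleWord G c is w

loop-toppleWord : ∀ G c f w →
  loop G f (st (toppleWord G c w) w) ≡ st (toppleWord G c (loopWord G c f w)) (loopWord G c f w)
loop-toppleWord G c zero w = refl
loop-toppleWord G c (suc f) w with allToppled G w
... | true = refl
... | false = trans (cong (loop G f) (pass-toppleWord G c (reverse (verts G)) w))
                    (loop-toppleWord G c f (passWord G c (reverse (verts G)) w))

outputWord≡loopWord : ∀ G κ → outputWord G κ ≡ loopWord G (toppleSink G κ) (size G) []
outputWord≡loopWord G κ = cong word (loop-toppleWord G (toppleSink G κ) (size G) [])

passWord-⊇ : ∀ G c is {w x} → x ∈ w → x ∈ passWord G c is w
passWord-⊇ G c [] x∈w = x∈w
passWord-⊇ G c (i ∷ is) {w} x∈w with unstable? G (toppleWord G c w) i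
... | true = passWord-⊇ G c is (∈-++⁺ˡ x∈w)
... | false = passWord-⊇ G c is x∈w

reverse-verts : ∀ G → reverse (verts G) ≡ map suc (downFrom (size G))
reverse-verts G = trans (sym (reverse-map suc (upTo (size G)))) (cong (map suc) (reverse-upTo (size G)))

reverse-verts-inRange : ∀ G → All (InRange G) (reverse (verts G))
reverse-verts-inRange G = All.tabulate (λ v∈ → ∈-vertices⁻ (reverse⁻ v∈))

passWord-VertexSet : ∀ G κ {is w} → Stable G κ → All (InRange G) is → VertexSet G w →
  VertexSet G (passWord G (toppleSink G κ) is w)
passWord-VertexSet G κ stable [] vs = vs
passWord-VertexSet G κ {i ∷ is} {w} stable (i-inRange ∷ is-inRange) vs
  with unstable? G (toppleWord G (toppleSink G κ) w) i | unstable?-reflects G (toppleWord G (toppleSink G κ) w) i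
... | true | ofʸ unstable = passWord-VertexSet G κ stable is-inRange
        (VertexSet-∷ʳ vs i-inRange (unstable⇒untoppled G κ stable vs i-inRange unstable))
... | false | _ = passWord-VertexSet G κ stable is-inRange vs

loopWord-VertexSet : ∀ G κ f {w} → Stable G κ → VertexSet G w → VertexSet G (loopWord G (toppleSink G κ) f w)
loopWord-VertexSet G κ zero stable vs = vs
loopWord-VertexSet G κ (suc f) {w} stable vs with allToppled G w
... | true = vs
... | false = loopWord-VertexSet G κ f stable (passWord-VertexSet G κ stable (reverse-verts-inRange G) vs)

NonNeg-topple : ∀ G {κ x} → NonNeg G κ → + deg G x ℤ.≤ κ x → NonNeg G (topple G x κ)
NonNeg-topple G {κ} {x} nonNeg unstable v v-inRange with v ℕ.≟ x
... | yes refl rewrite topple-self G v κ = ℤₚ.i≤j⇒0≤j-i unstable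
... | no v≢x rewrite topple-other G x v κ v≢x with adj G x v
...   | true = ℤₚ.≤-trans (nonNeg v v-inRange) (ℤₚ.i≤i+j (κ v) (+ 1))
...   | false = nonNeg v v-inRange

LegalSeq-∷ʳ : ∀ G c w {x} → LegalSeq G c w → NonNeg G (topple G x (toppleWord G c w)) →
  LegalSeq G c (w ++ [ x ])
LegalSeq-∷ʳ G c [] _ nonNeg = nonNeg , tt
LegalSeq-∷ʳ G c (y ∷ w) (nonNeg₀ , legal) nonNeg = nonNeg₀ , LegalSeq-∷ʳ G (topple G y c) w legal nonNeg

LegalWord : Graph → Config → List ℕ → Set
LegalWord G c w = LegalSeq G c w × NonNeg G (toppleWord G c w)

passWord-legal : ∀ G c is {w} → LegalWord G c w → LegalWord G c (passWord G c is w)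
passWord-legal G c [] legal = legal
passWord-legal G c (i ∷ is) {w} (legal , nonNeg)
  with unstable? G (toppleWord G c w) i | unstable?-reflects G (toppleWord G c w) i
... | true | ofʸ unstable = passWord-legal G c is
        ( LegalSeq-∷ʳ G c w legal nonNeg′
        , subst (NonNeg G) (sym (toppleWord-∷ʳ G c w i)) nonNeg′)
  where nonNeg′ = NonNeg-topple G nonNeg unstable
... | false | _ = passWord-legal G c is (legal , nonNeg)

loopWord-legal : ∀ G c f {w} → LegalWord G c w → LegalWord G c (loopWord G c f w)
loopWord-legal G c zero legal = legal
loopWord-legal G c (suc f) {w} legal with allToppled G w
... | true = legal
... | false = loopWord-legal G c f (passWord-legal G c (reverse (verts G)) legal)

any-≡ᵇ⇒∈ : ∀ v w → T (BL.any (λ u → u ≡ᵇ v) w) → v ∈ w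
any-≡ᵇ⇒∈ v w t = Any.map (λ {u} u≡ᵇv → sym (≡ᵇ⇒≡ u v u≡ᵇv)) (any⁻ _ w t)

∈⇒any-≡ᵇ : ∀ v w → v ∈ w → T (BL.any (λ u → u ≡ᵇ v) w)
∈⇒any-≡ᵇ v w v∈w = any⁺ _ (Any.map (λ { refl → ≡⇒≡ᵇ v v refl }) v∈w)

allToppled-reflects : ∀ G w → Reflects (All (_∈ w) (verts G)) (allToppled G w)
allToppled-reflects G w = fromEquivalence
  (λ t → All.map (λ {v} → any-≡ᵇ⇒∈ v w) (Allₚ.all⁺ _ (verts G) t))
  (λ all∈ → Allₚ.all⁻ _ (All.map (λ {v} → ∈⇒any-≡ᵇ v w) all∈))

-- Recurrent configurations are toppled completely

private
  Unique-++⁻ˡ : ∀ (xs : List ℕ) {ys} → Unique (xs ++ ys) → Unique xs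
  Unique-++⁻ˡ [] _ = []
  Unique-++⁻ˡ (x ∷ xs) (x∉ ∷ u) = Allₚ.++⁻ˡ xs x∉ ∷ Unique-++⁻ˡ xs u

  Unique-++-∷⁻ : ∀ (xs : List ℕ) {y ys} → Unique (xs ++ y ∷ ys) → y ∉ xs
  Unique-++-∷⁻ (x ∷ xs) (x∉ ∷ _) (here refl) = All.lookup x∉ (∈-++⁺ʳ xs (here refl)) refl
  Unique-++-∷⁻ (x ∷ xs) (_ ∷ u) (there y∈xs) = Unique-++-∷⁻ xs u y∈xs

-- Along a legal sequence, the first vertex x that the word w has not toppled was unstable
-- after the toppled prefix p; as p is part of w, x is even fuller after w.
legal⇒untoppled-unstable : ∀ G c {σ w} → Unique σ → All (InRange G) σ → LegalSeq G c σ →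
  Any (_∉ w) σ → ∃[ x ] InRange G x × x ∉ w × (+ deg G x ℤ.≤ toppleWord G c w x)
legal⇒untoppled-unstable G c {σ} {w} u inRange legal untoppled =
  walk [] u (λ ()) inRange legal untoppled
  where
  walk : ∀ p {σ} → Unique (p ++ σ) → (∀ {x} → x ∈ p → x ∈ w) → All (InRange G) σ →
         LegalSeq G (toppleWord G c p) σ → Any (_∉ w) σ →
         ∃[ x ] InRange G x × x ∉ w × (+ deg G x ℤ.≤ toppleWord G c w x)
  walk p {y ∷ σ} u p⊆w (y-inRange ∷ inRange) (nonNeg , legal) untoppled with y ∈? w
  ... | no y∉w = y , y-inRange , y∉w , ℤₚ.≤-trans unstable-after-p more-after-w
    where
    open ℤₚ.≤-Reasoning
    y∉p = Unique-++-∷⁻ p u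
    unstable-after-p : + deg G y ℤ.≤ toppleWord G c p y
    unstable-after-p = ℤₚ.0≤i-j⇒j≤i
      (subst (0ℤ ℤ.≤_) (topple-self G y (toppleWord G c p)) (nonNeg y y-inRange))
    more-after-w : toppleWord G c p y ℤ.≤ toppleWord G c w y
    more-after-w = begin
      toppleWord G c p y          ≡⟨ toppleWord-∉ G c y∉p ⟩
      c y ℤ.+ + neighbours G y p  ≤⟨ ℤₚ.+-monoʳ-≤ (c y) (ℤ.+≤+ (countᵇ-⊆ (Unique-++⁻ˡ p u) (λ x∈p _ → p⊆w x∈p))) ⟩
      c y ℤ.+ + neighbours G y w  ≡⟨ toppleWord-∉ G c y∉w ⟨
      toppleWord G c w y          ∎
  ... | yes y∈w with untoppled
  ...   | here y∉w = ⊥-elim (y∉w y∈w)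
  ...   | there untoppled′ =
    walk (p ++ [ y ]) (subst Unique (sym (++-assoc p [ y ] σ)) u)
         (λ x∈p++y → [ p⊆w , (λ { (here refl) → y∈w }) ]′ (∈-++⁻ p x∈p++y))
         inRange (subst (λ κ → LegalSeq G κ σ) (sym (toppleWord-∷ʳ G c p y)) legal) untoppled′

-- Either the pass topples something before reaching u, and that vertex is new because
-- toppled vertices are stable, or it reaches u unchanged and topples u.
passWord-topples-new : ∀ G κ k {w u} → Stable G κ → VertexSet G w → k ≤ size G →
  InRange G u → u ≤ k → u ∉ w → + deg G u ℤ.≤ toppleWord G (toppleSink G κ) w u →
  ∃[ x ] x ∉ w × x ∈ passWord G (toppleSink G κ) (map suc (downFrom k)) w
passWord-topples-new G κ zero stable vs _ (1≤u , _) u≤0 _ _ = ⊥-elim (<-irrefl refl (≤-trans 1≤u u≤0))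
passWord-topples-new G κ (suc k) {w} {u} stable vs k<n u-inRange u≤1+k u∉w u-unstable
  with unstable? G (toppleWord G (toppleSink G κ) w) (suc k)
     | unstable?-reflects G (toppleWord G (toppleSink G κ) w) (suc k)
... | true | ofʸ unstable =
  suc k , unstable⇒untoppled G κ stable vs (s≤s z≤n , k<n) unstable ,
  passWord-⊇ G _ (map suc (downFrom k)) (∈-++⁺ʳ w (here refl))
... | false | ofⁿ stable-1+k with m≤n⇒m<n∨m≡n u≤1+k
...   | inj₂ refl = ⊥-elim (stable-1+k u-unstable)
...   | inj₁ u≤k = passWord-topples-new G κ k stable vs (<⇒≤ k<n) u-inRange (≤-pred u≤k) u∉w u-unstable

untoppled⇒length< : ∀ G {w v} → VertexSet G w → v ∈ verts G → v ∉ w → length w < size G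
untoppled⇒length< G {w} vs v∈verts v∉w = subst (length w <_) (length-vertices (size G))
  (length-⊆ (All.tabulate (λ x∈w → λ { refl → v∉w x∈w }) ∷ unique vs)
            (λ { (here refl) → v∈verts ; (there x∈w) → uncurry ∈-vertices⁺ (All.lookup (inRange vs) x∈w) }))

passWord-grows : ∀ G κ {σ w} → Stable G κ → σ ↭ verts G → LegalSeq G (toppleSink G κ) σ → VertexSet G w →
  Any (_∉ w) (verts G) → length w < length (passWord G (toppleSink G κ) (reverse (verts G)) w)
passWord-grows G κ {σ} {w} stable σ↭ legal vs untoppled = grows new
  where
  c = toppleSink G κ
  w′ = passWord G c (reverse (verts G)) w
  σ-unique : Unique σ
  σ-unique = Unique-resp-↭ (↭⇒↭ₛ (↭-sym σ↭)) (vertices-unique (size G))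
  σ-inRange : All (InRange G) σ
  σ-inRange = All-resp-↭ (↭-sym σ↭) (All.tabulate ∈-vertices⁻)
  new : ∃[ x ] x ∉ w × x ∈ w′
  new with u , u-inRange , u∉w , u-unstable ←
           legal⇒untoppled-unstable G c σ-unique σ-inRange legal (Any-resp-↭ (↭-sym σ↭) untoppled)
    rewrite reverse-verts G =
    passWord-topples-new G κ (size G) stable vs ≤-refl u-inRange (proj₂ u-inRange) u∉w u-unstable
  grows : ∃[ x ] x ∉ w × x ∈ w′ → length w < length w′
  grows (x , x∉w , x∈w′) =
    length-⊆ (All.tabulate (λ y∈w → λ { refl → x∉w y∈w }) ∷ unique vs)
             (λ { (here refl) → x∈w′ ; (there y∈w) → passWord-⊇ G c (reverse (verts G)) y∈w })

-- Every unfinished pass lengthens the duplicate-free word w, which has at most size G letters.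
loopWord-topples-all : ∀ G κ {σ} → Stable G κ → σ ↭ verts G → LegalSeq G (toppleSink G κ) σ →
  ∀ f {w} → VertexSet G w → size G ≤ f + length w → All (_∈ loopWord G (toppleSink G κ) f w) (verts G)
loopWord-topples-all G κ stable σ↭ legal zero {w} vs n≤len with allToppled G w | allToppled-reflects G w
... | _ | ofʸ all = all
... | _ | ofⁿ ¬all with v , v∈verts , v∉w ← find (Allₚ.¬All⇒Any¬ (_∈? w) (verts G) ¬all) =
  ⊥-elim (<-irrefl refl (≤-trans (s≤s n≤len) (untoppled⇒length< G vs v∈verts v∉w)))
loopWord-topples-all G κ stable σ↭ legal (suc f) {w} vs n≤len with allToppled G w | allToppled-reflects G w
... | true | ofʸ all = all
... | false | ofⁿ ¬all =
  loopWord-topples-all G κ stable σ↭ legal f (passWord-VertexSet G κ stable (reverse-verts-inRange G) vs)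
    (≤-trans n≤len (subst (_≤ f + length (passWord G (toppleSink G κ) (reverse (verts G)) w)) (+-suc f (length w))
                          (+-monoʳ-≤ f longer)))
  where
  longer = passWord-grows G κ stable σ↭ legal vs (Allₚ.¬All⇒Any¬ (_∈? w) (verts G) ¬all)

loopWord-↭ : ∀ G κ → Recurrent G κ → loopWord G (toppleSink G κ) (size G) [] ↭ verts G
loopWord-↭ G κ (stable , σ , σ↭ , _ , legal) = ∼bag⇒↭ (unique∧set⇒bag (unique vs) (vertices-unique (size G))
  (mk⇔ (λ v∈ → uncurry ∈-vertices⁺ (All.lookup (inRange vs) v∈)) (All.lookup all-toppled)))
  where
  vs = loopWord-VertexSet G κ (size G) stable ([]-VertexSet G)
  all-toppled = loopWord-topples-all G κ stable σ↭ legal (size G) ([]-VertexSet G)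
                  (≤-reflexive (sym (+-identityʳ (size G))))

-- Locating the components

totalSize : List (Bool × ℕ) → ℕ
totalSize bs = sum (map proj₂ bs)

totalSize-blocks : ∀ G → totalSize (blocks G) ≡ size G
totalSize-blocks G = begin
  sum (map proj₂ (map (false ,_) (ν G) ++ reverse (map (true ,_) (μ G))))
    ≡⟨ cong sum (map-++ proj₂ (map (false ,_) (ν G)) _) ⟩
  sum (map proj₂ (map (false ,_) (ν G)) ++ map proj₂ (reverse (map (true ,_) (μ G))))
    ≡⟨ sum-++ (map proj₂ (map (false ,_) (ν G))) _ ⟩
  sum (map proj₂ (map (false ,_) (ν G))) + sum (map proj₂ (reverse (map (true ,_) (μ G))))
    ≡⟨ cong₂ _+_ (cong sum (labels-forgotten false (ν G)))
                 (trans (cong sum (reverse-map proj₂ (map (true ,_) (μ G))))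
                 (trans (sum-↭ (↭-reverse (map proj₂ (map (true ,_) (μ G)))))
                        (cong sum (labels-forgotten true (μ G))))) ⟩
  sum (ν G) + sum (μ G)
    ≡⟨ +-comm (sum (ν G)) (sum (μ G)) ⟩
  size G ∎
  where
  open ≡-Reasoning
  labels-forgotten : ∀ (b : Bool) (ks : List ℕ) → map proj₂ (map (λ k → (b , k)) ks) ≡ ks
  labels-forgotten b ks = trans (sym (map-∘ ks)) (map-id ks)

record LocateSpec (base i u : ℕ) (l : Loc) : Set where
  field
    base<start : base < start l
    start≤u    : start l ≤ u
    u<end      : u < start l + bsize l
    i≤idx      : i ≤ idx l

open LocateSpec

locate-spec : ∀ bs base i {u} → base < u → u ≤ base + totalSize bs → LocateSpec base i u (locate bs base i u)
locate-spec [] base i base<u u≤base+0 =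
  ⊥-elim (<⇒≱ base<u (subst (_ ≤_) (+-identityʳ base) u≤base+0))
locate-spec ((b , s) ∷ bs) base i {u} base<u u≤end with u ≤ᵇ base + s | ≤ᵇ-reflects-≤ u (base + s)
... | true | ofʸ u≤base+s = record
  { base<start = ≤-refl ; start≤u = base<u ; u<end = s≤s u≤base+s ; i≤idx = ≤-refl }
... | false | ofⁿ u≰base+s = record
  { base<start = ≤-trans (s≤s (m≤m+n base s)) (base<start spec)
  ; start≤u = start≤u spec
  ; u<end = u<end spec
  ; i≤idx = ≤-trans (n≤1+n i) (i≤idx spec)
  }
  where spec = locate-spec bs (base + s) (suc i) (≰⇒> u≰base+s) (subst (u ≤_) (sym (+-assoc base s _)) u≤end)

private
  locate-spec-tail : ∀ bs base s i {w} → ¬ w ≤ base + s → w ≤ base + (s + totalSize bs) →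
    LocateSpec (base + s) (suc i) w (locate bs (base + s) (suc i) w)
  locate-spec-tail bs base s i {w} w≰ w≤end =
    locate-spec bs (base + s) (suc i) (≰⇒> w≰) (subst (w ≤_) (sym (+-assoc base s _)) w≤end)

locate-block : ∀ bs base i {u v} → base < u → u ≤ base + totalSize bs →
  start (locate bs base i u) ≤ v → v < start (locate bs base i u) + bsize (locate bs base i u) →
  locate bs base i v ≡ locate bs base i u
locate-block [] base i base<u u≤base+0 =
  ⊥-elim (<⇒≱ base<u (subst (_ ≤_) (+-identityʳ base) u≤base+0))
locate-block ((b , s) ∷ bs) base i {u} {v} base<u u≤end with u ≤ᵇ base + s | ≤ᵇ-reflects-≤ u (base + s)
... | true | ofʸ _ = λ { _ (s≤s v≤base+s) → cong branch (dec-true (v ℕ.≤? base + s) v≤base+s) }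
  where branch = if_then loc i b (suc base) s else locate bs (base + s) (suc i) v
... | false | ofⁿ u≰base+s = λ start≤v v<end →
  trans (cong branch (dec-false (v ℕ.≤? base + s) (<⇒≱ (<-≤-trans (base<start spec) start≤v))))
        (locate-block bs (base + s) (suc i) (≰⇒> u≰base+s) (subst (u ≤_) (sym (+-assoc base s _)) u≤end)
                      start≤v v<end)
  where
  branch = if_then loc i b (suc base) s else locate bs (base + s) (suc i) v
  spec = locate-spec-tail bs base s i u≰base+s u≤end

locate-idx-injective : ∀ bs base i {u v} → base < u → u ≤ base + totalSize bs → base < v → v ≤ base + totalSize bs →
  idx (locate bs base i u) ≡ idx (locate bs base i v) → locate bs base i u ≡ locate bs base i v
locate-idx-injective [] base i base<u u≤base+0 _ _ _ =
  ⊥-elim (<⇒≱ base<u (subst (_ ≤_) (+-identityʳ base) u≤base+0))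
locate-idx-injective ((b , s) ∷ bs) base i {u} {v} base<u u≤end base<v v≤end
  with u ≤ᵇ base + s | ≤ᵇ-reflects-≤ u (base + s) | v ≤ᵇ base + s | ≤ᵇ-reflects-≤ v (base + s)
... | true  | _ | true  | _ = λ _ → refl
... | true  | _ | false | ofⁿ v≰ =
  λ i≡idx → ⊥-elim (<-irrefl i≡idx (i≤idx (locate-spec-tail bs base s i v≰ v≤end)))
... | false | ofⁿ u≰ | true  | _ =
  λ idx≡i → ⊥-elim (<-irrefl (sym idx≡i) (i≤idx (locate-spec-tail bs base s i u≰ u≤end)))
... | false | ofⁿ u≰ | false | ofⁿ v≰ =
  locate-idx-injective bs (base + s) (suc i) (≰⇒> u≰) (subst (u ≤_) (sym (+-assoc base s _)) u≤end)
                                             (≰⇒> v≰) (subst (v ≤_) (sym (+-assoc base s _)) v≤end)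

module _ (G : Graph) where

  private
    ≤-totalSize : ∀ {v} → InRange G v → v ≤ 0 + totalSize (blocks G)
    ≤-totalSize (_ , v≤n) = subst (_ ≤_) (sym (totalSize-blocks G)) v≤n

  locOf-spec : ∀ {v} → InRange G v → LocateSpec 0 0 v (locOf G v)
  locOf-spec v-inRange = locate-spec (blocks G) 0 0 (proj₁ v-inRange) (≤-totalSize v-inRange)

  locOf-block : ∀ {u v} → InRange G v → start (locOf G v) ≤ u → u < start (locOf G v) + bsize (locOf G v) →
    locOf G u ≡ locOf G v
  locOf-block v-inRange = locate-block (blocks G) 0 0 (proj₁ v-inRange) (≤-totalSize v-inRange)

  locOf-idx-injective : ∀ {u v} → InRange G u → InRange G v → idx (locOf G u) ≡ idx (locOf G v) →
    locOf G u ≡ locOf G v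
  locOf-idx-injective u-inRange v-inRange =
    locate-idx-injective (blocks G) 0 0 (proj₁ u-inRange) (≤-totalSize u-inRange)
                                        (proj₁ v-inRange) (≤-totalSize v-inRange)

-- Comparing Ĝ μ ν with Ĝ⊔ μ ν

Reflects-≡ : ∀ {P Q : Set} {b b′} → Reflects P b → Reflects Q b′ → P ⇔ Q → b ≡ b′
Reflects-≡ (ofʸ _) (ofʸ _) _ = refl
Reflects-≡ (ofʸ p) (ofⁿ ¬q) P⇔Q = ⊥-elim (¬q (Equivalence.to P⇔Q p))
Reflects-≡ (ofⁿ ¬p) (ofʸ q) P⇔Q = ⊥-elim (¬p (Equivalence.from P⇔Q q))
Reflects-≡ (ofⁿ _) (ofⁿ _) _ = refl

shifted-threshold : ∀ (d x : ℤ) (D u U : ℕ) → u ≤ U → (d ℤ.≤ x → u ≡ U) →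
  d ℤ.≤ x ⇔ d ℤ.+ + (D + U) ℤ.≤ x ℤ.+ + (D + u)
shifted-threshold d x D u U u≤U reached = mk⇔
  (λ d≤x → subst (λ k → d ℤ.+ + (D + k) ℤ.≤ x ℤ.+ + (D + u)) (reached d≤x) (ℤₚ.+-monoˡ-≤ (+ (D + u)) d≤x))
  (λ shifted → +-cancelʳ-≤ d x (+ (D + U))
     (ℤₚ.≤-trans shifted (ℤₚ.+-monoʳ-≤ x (ℤ.+≤+ (+-monoʳ-≤ D u≤U)))))

module _ (μ ν : List ℕ) where

  private
    G₁ G₂ : Graph
    G₁ = Ĝ μ ν
    G₂ = Ĝ⊔ μ ν

    n : ℕ
    n = size G₁

    L : ℕ → Loc
    L = locOf G₁

  sameBlock : ℕ → ℕ → Bool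
  sameBlock v x = idx (L x) ≡ᵇ idx (L v)

  lowerMate upperMate : ℕ → ℕ → Bool
  lowerMate v x = sameBlock v x ∧ (x <ᵇ v)
  upperMate v x = sameBlock v x ∧ (v <ᵇ x)

  sameBlock-reflects : ∀ v x → Reflects (idx (L x) ≡ idx (L v)) (sameBlock v x)
  sameBlock-reflects v x = ≡ᵇ-reflects (idx (L x)) (idx (L v))

  sameBlock⇒≡ : ∀ {v x} → InRange G₁ v → InRange G₁ x → sameBlock v x ≡ true → L x ≡ L v
  sameBlock⇒≡ {v} {x} v-inRange x-inRange sb with sameBlock v x | sameBlock-reflects v x
  ... | true | ofʸ idx≡ = locOf-idx-injective G₁ x-inRange v-inRange idx≡

  ≡⇒sameBlock : ∀ {v x} → L x ≡ L v → sameBlock v x ≡ true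
  ≡⇒sameBlock {v} L≡ rewrite L≡ = ≡ᵇ-refl (idx (L v))

  adj-Ĝ⊔ : ∀ x v → adj G₂ x v ≡ not (x ≡ᵇ v)
  adj-Ĝ⊔ x v rewrite ∨-zeroʳ (clique (L x)) | ∨-zeroʳ (not (idx (L x) ≡ᵇ idx (L v))) = ∧-identityʳ _

  adj-Ĝ-clique : ∀ {x v} → InRange G₁ x → InRange G₁ v → clique (L v) ≡ true → adj G₁ x v ≡ not (x ≡ᵇ v)
  adj-Ĝ-clique {x} {v} x-inRange v-inRange v-clique
    with idx (L x) ≡ᵇ idx (L v) | ≡ᵇ-reflects (idx (L x)) (idx (L v))
  ... | false | _ = ∧-identityʳ _
  ... | true | ofʸ idx≡ rewrite locOf-idx-injective G₁ x-inRange v-inRange idx≡ | v-clique = ∧-identityʳ _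

  adj-Ĝ-independent : ∀ {x v} → InRange G₁ x → InRange G₁ v → clique (L v) ≡ false →
    adj G₁ x v ≡ not (sameBlock v x)
  adj-Ĝ-independent {x} {v} x-inRange v-inRange v-indep with x ℕ.≟ v
  ... | yes refl rewrite ≡ᵇ-refl x | ≡ᵇ-refl (idx (L x)) = refl
  ... | no x≢v rewrite ≢⇒≡ᵇ-false x v x≢v with sameBlock v x | sameBlock-reflects v x
  ...   | false | _ = refl
  ...   | true | ofʸ idx≡ rewrite locOf-idx-injective G₁ x-inRange v-inRange idx≡ | v-indep = refl

  adj-mates : ∀ {x p y} → InRange G₁ x → InRange G₁ p → InRange G₁ y → L p ≡ L y → clique (L y) ≡ false →
    adj G₁ x p ≡ adj G₁ x y
  adj-mates {x} x-inRange p-inRange y-inRange Lp≡Ly y-indep =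
    trans (adj-Ĝ-independent x-inRange p-inRange (trans (cong clique Lp≡Ly) y-indep))
          (trans (cong (λ l → not (idx (L x) ≡ᵇ idx l)) Lp≡Ly)
                 (sym (adj-Ĝ-independent x-inRange y-inRange y-indep)))

  neighbours-mates : ∀ {xs p y} → All (InRange G₁) xs → InRange G₁ p → InRange G₁ y → L p ≡ L y →
    clique (L y) ≡ false → neighbours G₁ p xs ≡ neighbours G₁ y xs
  neighbours-mates xs-inRange p-inRange y-inRange Lp≡Ly y-indep =
    countᵇ-cong (λ x∈ → adj-mates (All.lookup xs-inRange x∈) p-inRange y-inRange Lp≡Ly y-indep)

  deg-mates : ∀ {p y} → InRange G₁ p → InRange G₁ y → L p ≡ L y → clique (L y) ≡ false →
    deg G₁ p ≡ deg G₁ y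
  deg-mates {p} {y} p-inRange y-inRange Lp≡Ly y-indep =
    trans (deg≡suc-neighbours G₁ p)
          (trans (cong suc (neighbours-mates (All.tabulate ∈-vertices⁻) p-inRange y-inRange Lp≡Ly y-indep))
                 (sym (deg≡suc-neighbours G₁ y)))

  lowerMate⇒ : ∀ {v x} → InRange G₁ v → InRange G₁ x → lowerMate v x ≡ true → L x ≡ L v × x < v
  lowerMate⇒ {v} {x} v-inRange x-inRange mate with sameBlock v x in sb | x <ᵇ v | <ᵇ-reflects-< x v | mate
  ... | true | true | ofʸ x<v | _ = sameBlock⇒≡ v-inRange x-inRange sb , x<v

  upperMate⇒ : ∀ {v x} → InRange G₁ v → InRange G₁ x → upperMate v x ≡ true → L x ≡ L v × v < x
  upperMate⇒ {v} {x} v-inRange x-inRange mate with sameBlock v x in sb | v <ᵇ x | <ᵇ-reflects-< v x | mate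
  ... | true | true | ofʸ v<x | _ = sameBlock⇒≡ v-inRange x-inRange sb , v<x

  not≡ᵇ-partition : ∀ {x v} → InRange G₁ x → InRange G₁ v → clique (L v) ≡ false →
    not (x ≡ᵇ v) ≡ (adj G₁ x v ∨ (lowerMate v x ∨ upperMate v x))
  not≡ᵇ-partition {x} {v} x-inRange v-inRange v-indep
    rewrite adj-Ĝ-independent x-inRange v-inRange v-indep with sameBlock v x | sameBlock-reflects v x
  ... | true | _ = ≢ᵇ≡<ᵇ∨>ᵇ x v
  ... | false | ofⁿ ¬idx≡ rewrite ≢⇒≡ᵇ-false x v (λ { refl → ¬idx≡ refl }) = refl

  adj∧mate≡false : ∀ {x v} → InRange G₁ x → InRange G₁ v → clique (L v) ≡ false →
    (adj G₁ x v ∧ (lowerMate v x ∨ upperMate v x)) ≡ false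
  adj∧mate≡false {x} {v} x-inRange v-inRange v-indep
    rewrite adj-Ĝ-independent x-inRange v-inRange v-indep with sameBlock v x
  ... | true = refl
  ... | false = refl

  lowerMate∧upperMate≡false : ∀ v x → (lowerMate v x ∧ upperMate v x) ≡ false
  lowerMate∧upperMate≡false v x with sameBlock v x
  ... | true = <ᵇ∧>ᵇ≡false x v
  ... | false = refl

  neighbours-Ĝ⊔-clique : ∀ {v xs} → InRange G₁ v → clique (L v) ≡ true → All (InRange G₁) xs →
    neighbours G₂ v xs ≡ neighbours G₁ v xs
  neighbours-Ĝ⊔-clique {v} v-inRange v-clique xs-inRange = countᵇ-cong λ {x} x∈ →
    trans (adj-Ĝ⊔ x v) (sym (adj-Ĝ-clique (All.lookup xs-inRange x∈) v-inRange v-clique))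

  neighbours-Ĝ⊔-independent : ∀ {v xs} → InRange G₁ v → clique (L v) ≡ false → All (InRange G₁) xs →
    neighbours G₂ v xs ≡ neighbours G₁ v xs + (countᵇ (lowerMate v) xs + countᵇ (upperMate v) xs)
  neighbours-Ĝ⊔-independent {v} {xs} v-inRange v-indep xs-inRange = begin
    neighbours G₂ v xs
      ≡⟨ countᵇ-cong (λ {x} x∈ → trans (adj-Ĝ⊔ x v)
                                        (not≡ᵇ-partition (All.lookup xs-inRange x∈) v-inRange v-indep)) ⟩
    countᵇ (λ x → adj G₁ x v ∨ (lowerMate v x ∨ upperMate v x)) xs
      ≡⟨ countᵇ-∨ (λ x∈ → adj∧mate≡false (All.lookup xs-inRange x∈) v-inRange v-indep) ⟩
    neighbours G₁ v xs + countᵇ (λ x → lowerMate v x ∨ upperMate v x) xs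
      ≡⟨ cong (λ k → neighbours G₁ v xs + k)
              (countᵇ-∨ {xs = xs} {P = lowerMate v} {Q = upperMate v} (λ {x} _ → lowerMate∧upperMate≡false v x)) ⟩
    neighbours G₁ v xs + (countᵇ (lowerMate v) xs + countᵇ (upperMate v) xs) ∎
    where open ≡-Reasoning

  private
    start≤ : ∀ {v} → InRange G₁ v → start (L v) ≤ v
    start≤ v-inRange = start≤u (locOf-spec G₁ v-inRange)

    <end : ∀ {v} → InRange G₁ v → v < start (L v) + bsize (L v)
    <end v-inRange = u<end (locOf-spec G₁ v-inRange)

  lowerMate∨<start : ∀ {x v} → InRange G₁ x → InRange G₁ v →
    (lowerMate v x ∨ (x <ᵇ start (L v))) ≡ (x <ᵇ v)
  lowerMate∨<start {x} {v} x-inRange v-inRange with x <ᵇ v | <ᵇ-reflects-< x v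
  ... | false | ofⁿ x≮v
    rewrite dec-false (x ℕ.<? start (L v)) (λ x<a → x≮v (<-≤-trans x<a (start≤ v-inRange)))
    = cong (_∨ false) (∧-zeroʳ (sameBlock v x))
  ... | true | ofʸ x<v with x <ᵇ start (L v) | <ᵇ-reflects-< x (start (L v))
  ...   | true | _ = ∨-zeroʳ _
  ...   | false | ofⁿ x≮a
    rewrite ≡⇒sameBlock {v} {x} (locOf-block G₁ v-inRange (≮⇒≥ x≮a) (<-trans x<v (<end v-inRange))) = refl

  lowerMate∧<start≡false : ∀ {x v} → InRange G₁ x → InRange G₁ v →
    (lowerMate v x ∧ (x <ᵇ start (L v))) ≡ false
  lowerMate∧<start≡false {x} {v} x-inRange v-inRange with sameBlock v x in sb
  ... | false = refl
  ... | true rewrite dec-false (x ℕ.<? start (L v))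
                       (≤⇒≯ (subst (λ l → start l ≤ x) (sameBlock⇒≡ v-inRange x-inRange sb) (start≤ x-inRange)))
    = ∧-zeroʳ _

  countᵇ-lowerMate : ∀ {v} → InRange G₁ v → countᵇ (lowerMate v) (verts G₁) ≡ v ∸ start (L v)
  countᵇ-lowerMate {v} v-inRange@(1≤v , v≤n) = +-cancelʳ-≡ (a ∸ 1) _ _ (begin
    countᵇ (lowerMate v) vs + (a ∸ 1)
      ≡⟨ cong (λ k → countᵇ (lowerMate v) vs + k)
              (countᵇ-<ᵇ-vertices n a 1≤a (m≤n⇒m≤1+n (≤-trans (start≤ v-inRange) v≤n))) ⟨
    countᵇ (lowerMate v) vs + countᵇ (_<ᵇ a) vs
      ≡⟨ countᵇ-∨ (λ x∈ → lowerMate∧<start≡false (∈-vertices⁻ x∈) v-inRange) ⟨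
    countᵇ (λ x → lowerMate v x ∨ (x <ᵇ a)) vs
      ≡⟨ countᵇ-cong (λ x∈ → lowerMate∨<start (∈-vertices⁻ x∈) v-inRange) ⟩
    countᵇ (_<ᵇ v) vs
      ≡⟨ countᵇ-<ᵇ-vertices n v 1≤v (m≤n⇒m≤1+n v≤n) ⟩
    v ∸ 1
      ≡⟨ ∸-split 1≤a (start≤ v-inRange) ⟩
    (v ∸ a) + (a ∸ 1) ∎)
    where
    open ≡-Reasoning
    vs = verts G₁
    a = start (L v)
    1≤a = base<start (locOf-spec G₁ v-inRange)
    ∸-split : ∀ {a v} → 1 ≤ a → a ≤ v → v ∸ 1 ≡ (v ∸ a) + (a ∸ 1)
    ∸-split {suc a} {suc v} _ (s≤s a≤v) = sym (m∸n+n≡m a≤v)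

  upperMates : ℕ → ℕ
  upperMates v = countᵇ (upperMate v) (verts G₁)

  deg-Ĝ⊔-clique : ∀ {v} → InRange G₁ v → clique (L v) ≡ true → deg G₂ v ≡ deg G₁ v
  deg-Ĝ⊔-clique {v} v-inRange v-clique =
    trans (deg≡suc-neighbours G₂ v)
          (trans (cong suc (neighbours-Ĝ⊔-clique v-inRange v-clique (All.tabulate ∈-vertices⁻)))
                 (sym (deg≡suc-neighbours G₁ v)))

  deg-Ĝ⊔-independent : ∀ {v} → InRange G₁ v → clique (L v) ≡ false →
    deg G₂ v ≡ deg G₁ v + ((v ∸ start (L v)) + upperMates v)
  deg-Ĝ⊔-independent {v} v-inRange v-indep = begin
    deg G₂ v
      ≡⟨ deg≡suc-neighbours G₂ v ⟩
    suc (neighbours G₂ v (verts G₁))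
      ≡⟨ cong suc (neighbours-Ĝ⊔-independent v-inRange v-indep (All.tabulate ∈-vertices⁻)) ⟩
    suc (neighbours G₁ v (verts G₁) + (countᵇ (lowerMate v) (verts G₁) + upperMates v))
      ≡⟨ cong (λ k → suc (neighbours G₁ v (verts G₁) + (k + upperMates v))) (countᵇ-lowerMate v-inRange) ⟩
    suc (neighbours G₁ v (verts G₁) + ((v ∸ start (L v)) + upperMates v))
      ≡⟨ cong (_+ ((v ∸ start (L v)) + upperMates v)) (deg≡suc-neighbours G₁ v) ⟨
    deg G₁ v + ((v ∸ start (L v)) + upperMates v) ∎
    where open ≡-Reasoning

  tilde-clique : ∀ κ {v} → clique (L v) ≡ true → tilde G₁ κ v ≡ κ v
  tilde-clique κ {v} v-clique with locOf G₁ v | v-clique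
  ... | loc _ true _ _ | refl = refl

  tilde-independent : ∀ κ {v} → InRange G₁ v → clique (L v) ≡ false →
    tilde G₁ κ v ≡ κ v ℤ.+ + (v ∸ start (L v))
  tilde-independent κ {v} v-inRange v-indep with locOf G₁ v | locOf-spec G₁ v-inRange | v-indep
  ... | loc _ false a s | spec | refl =
    cong (λ k → κ v ℤ.+ + k) (s∸[a+s∸v]≡v∸a (start≤u spec) (u<end spec))

  tilde-≥ : ∀ κ {v} → InRange G₁ v → κ v ℤ.≤ tilde G₁ κ v
  tilde-≥ κ {v} v-inRange with clique (L v) in v-clique
  ... | true = ℤₚ.≤-reflexive (sym (tilde-clique κ v-clique))
  ... | false = subst (κ v ℤ.≤_) (sym (tilde-independent κ v-inRange v-clique)) (ℤₚ.i≤i+j (κ v) _)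

  tilde-sorted : ∀ κ → Sorted G₁ κ → Sorted G₂ (tilde G₁ κ)
  tilde-sorted κ sorted i j i-inRange j-inRange i<j idx≡ = clique-case , independent-case
    where
    Li≡Lj = locOf-idx-injective G₁ i-inRange j-inRange idx≡
    clique-case : clique (L i) ≡ true → tilde G₁ κ j ℤ.≤ tilde G₁ κ i
    clique-case i-clique
      rewrite tilde-clique κ i-clique | tilde-clique κ (trans (cong clique (sym Li≡Lj)) i-clique) =
      proj₁ (sorted i j i-inRange j-inRange i<j idx≡) i-clique
    independent-case : clique (L i) ≡ false → tilde G₁ κ i ℤ.≤ tilde G₁ κ j
    independent-case i-indep
      rewrite tilde-independent κ i-inRange i-indep
            | tilde-independent κ j-inRange (trans (cong clique (sym Li≡Lj)) i-indep) =
      ℤₚ.+-mono-≤ (proj₂ (sorted i j i-inRange j-inRange i<j idx≡) i-indep)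
                  (ℤ.+≤+ (subst (λ l → i ∸ start l ≤ j ∸ start (L j)) (sym Li≡Lj)
                                (∸-monoˡ-≤ (start (L j)) (<⇒≤ i<j))))

  tilde-stable : ∀ κ → Stable G₁ κ → Stable G₂ (tilde G₁ κ)
  tilde-stable κ stable v v-inRange with clique (L v) in v-clique
  ... | true rewrite tilde-clique κ v-clique | deg-Ĝ⊔-clique v-inRange v-clique = stable v v-inRange
  ... | false rewrite tilde-independent κ v-inRange v-clique | deg-Ĝ⊔-independent v-inRange v-clique =
    ℤₚ.<-≤-trans (ℤₚ.+-monoˡ-< (+ (v ∸ start (L v))) (stable v v-inRange))
                 (ℤ.+≤+ (+-monoʳ-≤ (deg G₁ v) (m≤m+n _ _)))

  -- Running the algorithm on both graphs

  module _ (κ : Config) (sorted : Sorted G₁ κ) (stable : Stable G₁ κ) where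

    private
      κ̃ c₁ c₂ : Config
      κ̃ = tilde G₁ κ
      c₁ = toppleSink G₁ κ
      c₂ = toppleSink G₂ κ̃

    SameIndependent : ℕ → ℕ → Set
    SameIndependent x y = L x ≡ L y × clique (L y) ≡ false

    record Invariant (w : List ℕ) : Set where
      field
        vertexSet : VertexSet G₁ w
        upClosed  : ∀ {x y} → InRange G₁ x → InRange G₁ y → x < y → SameIndependent x y → x ∈ w → y ∈ w

    open Invariant

    CheckedStable : ℕ → List ℕ → Set
    CheckedStable k w = ∀ {y u} → InRange G₁ y → InRange G₁ u → y ≤ k → k < u → SameIndependent y u →
      u ∉ w → toppleWord G₁ c₁ w u ℤ.< + deg G₁ u

    -- A sorted configuration is weakly increasing on each independent component, and mates
    -- have the same neighbours, so an untoppled lower mate never holds more chips.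
    lower-mate-stable : ∀ {w p y} → All (InRange G₁) w → InRange G₁ p → InRange G₁ y → p < y →
      SameIndependent p y → p ∉ w → y ∉ w → toppleWord G₁ c₁ w y ℤ.< + deg G₁ y →
      toppleWord G₁ c₁ w p ℤ.< + deg G₁ p
    lower-mate-stable {w} {p} {y} w-inRange p-inRange y-inRange p<y (Lp≡Ly , y-indep) p∉w y∉w y-stable =
      subst₂ ℤ._<_ (sym (toppleWord-∉ G₁ c₁ p∉w)) (cong +_ (sym (deg-mates p-inRange y-inRange Lp≡Ly y-indep)))
        (ℤₚ.≤-<-trans (ℤₚ.+-mono-≤ (ℤₚ.+-monoˡ-≤ (+ 1) κp≤κy)
                                   (ℤₚ.≤-reflexive (cong +_ same-neighbours)))
                      (subst (ℤ._< + deg G₁ y) (toppleWord-∉ G₁ c₁ y∉w) y-stable))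
      where
      κp≤κy : κ p ℤ.≤ κ y
      κp≤κy = proj₂ (sorted p y p-inRange y-inRange p<y (cong idx Lp≡Ly)) (trans (cong clique Lp≡Ly) y-indep)
      same-neighbours = neighbours-mates w-inRange p-inRange y-inRange Lp≡Ly y-indep

    private
      Threshold₁ Threshold₂ : List ℕ → ℕ → Set
      Threshold₁ w k = + deg G₁ k ℤ.≤ toppleWord G₁ c₁ w k
      Threshold₂ w k = + deg G₂ k ℤ.≤ toppleWord G₂ c₂ w k

      toppled-agree : ∀ {w k} → VertexSet G₁ w → InRange G₁ k → k ∈ w → Threshold₁ w k ⇔ Threshold₂ w k
      toppled-agree vs k-inRange k∈w = mk⇔
        (λ unstable → ⊥-elim (ℤₚ.<⇒≱ (toppled-stable G₁ κ stable vs k-inRange k∈w) unstable))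
        (λ unstable → ⊥-elim (ℤₚ.<⇒≱ (toppled-stable G₂ κ̃ (tilde-stable κ stable) vs₂ k-inRange k∈w) unstable))
        where vs₂ = record { unique = unique vs ; inRange = inRange vs }

      clique-agree : ∀ {w k} → VertexSet G₁ w → InRange G₁ k → k ∉ w → clique (L k) ≡ true →
        Threshold₁ w k ⇔ Threshold₂ w k
      clique-agree {w} {k} vs k-inRange k∉w k-clique =
        mk⇔ (subst₂ ℤ._≤_ (cong +_ (sym deg≡)) (sym load≡)) (subst₂ ℤ._≤_ (cong +_ deg≡) load≡)
        where
        open ≡-Reasoning
        deg≡ = deg-Ĝ⊔-clique k-inRange k-clique
        load≡ : toppleWord G₂ c₂ w k ≡ toppleWord G₁ c₁ w k
        load≡ = begin
          toppleWord G₂ c₂ w k                  ≡⟨ toppleWord-∉ G₂ c₂ k∉w ⟩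
          (κ̃ k ℤ.+ + 1) ℤ.+ + neighbours G₂ k w ≡⟨ cong₂ (λ t m → (t ℤ.+ + 1) ℤ.+ + m) (tilde-clique κ k-clique)
                                                          (neighbours-Ĝ⊔-clique k-inRange k-clique (inRange vs)) ⟩
          (κ k ℤ.+ + 1) ℤ.+ + neighbours G₁ k w ≡⟨ toppleWord-∉ G₁ c₁ k∉w ⟨
          toppleWord G₁ c₁ w k                  ∎

      no-lower-mate-toppled : ∀ {k w} → Invariant w → InRange G₁ k → k ∉ w → clique (L k) ≡ false →
        countᵇ (lowerMate k) w ≡ 0
      no-lower-mate-toppled {k} {w} inv k-inRange k∉w k-indep = countᵇ-none lower-untoppled
        where
        lower-untoppled : ∀ {x} → x ∈ w → lowerMate k x ≡ false
        lower-untoppled {x} x∈w with lowerMate k x in mate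
        ... | false = refl
        ... | true = ⊥-elim (k∉w (upClosed inv x-inRange k-inRange (proj₂ Lx≡Lk×x<k) (proj₁ Lx≡Lk×x<k , k-indep) x∈w))
          where
          x-inRange = All.lookup (inRange (vertexSet inv)) x∈w
          Lx≡Lk×x<k = lowerMate⇒ k-inRange x-inRange mate

      upperMates-≤ : ∀ {k w} → VertexSet G₁ w → countᵇ (upperMate k) w ≤ upperMates k
      upperMates-≤ vs = countᵇ-⊆ (unique vs) (λ x∈w _ → uncurry ∈-vertices⁺ (All.lookup (inRange vs) x∈w))

      upper-mates-toppled : ∀ {k w} → Invariant w → CheckedStable k w → InRange G₁ k → k ∉ w →
        clique (L k) ≡ false → Threshold₁ w k → countᵇ (upperMate k) w ≡ upperMates k
      upper-mates-toppled {k} {w} inv checked k-inRange k∉w k-indep unstable =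
        ≤-antisym (upperMates-≤ vs) (countᵇ-⊆ (vertices-unique n) upper∈w)
        where
        vs = vertexSet inv
        upper∈w : ∀ {x} → x ∈ verts G₁ → upperMate k x ≡ true → x ∈ w
        upper∈w {x} x∈verts mate with x ∈? w
        ... | yes x∈w = x∈w
        ... | no x∉w = ⊥-elim (ℤₚ.<⇒≱ k-stable unstable)
          where
          x-inRange = ∈-vertices⁻ x∈verts
          Lx≡Lk×k<x = upperMate⇒ k-inRange x-inRange mate
          mates : SameIndependent k x
          mates = sym (proj₁ Lx≡Lk×k<x) , trans (cong clique (proj₁ Lx≡Lk×k<x)) k-indep
          k-stable = lower-mate-stable (inRange vs) k-inRange x-inRange (proj₂ Lx≡Lk×k<x) mates k∉w x∉w
                       (checked k-inRange x-inRange ≤-refl (proj₂ Lx≡Lk×k<x) mates x∉w)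

      load-independent : ∀ {k w} → Invariant w → InRange G₁ k → k ∉ w → clique (L k) ≡ false →
        toppleWord G₂ c₂ w k ≡ toppleWord G₁ c₁ w k ℤ.+ + ((k ∸ start (L k)) + countᵇ (upperMate k) w)
      load-independent {k} {w} inv k-inRange k∉w k-indep = begin
        toppleWord G₂ c₂ w k
          ≡⟨ toppleWord-∉ G₂ c₂ k∉w ⟩
        (κ̃ k ℤ.+ + 1) ℤ.+ + neighbours G₂ k w
          ≡⟨ cong₂ (λ t m → (t ℤ.+ + 1) ℤ.+ + m) (tilde-independent κ k-inRange k-indep)
                   (neighbours-Ĝ⊔-independent k-inRange k-indep (inRange (vertexSet inv))) ⟩
        ((κ k ℤ.+ + D) ℤ.+ + 1) ℤ.+ + (N₁ + (countᵇ (lowerMate k) w + up))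
          ≡⟨ cong (λ z → ((κ k ℤ.+ + D) ℤ.+ + 1) ℤ.+ + (N₁ + (z + up)))
                  (no-lower-mate-toppled inv k-inRange k∉w k-indep) ⟩
        ((κ k ℤ.+ + D) ℤ.+ + 1) ℤ.+ (+ N₁ ℤ.+ + up)
          ≡⟨ reorder (κ k) (+ D) (+ N₁) (+ up) ⟩
        ((κ k ℤ.+ + 1) ℤ.+ + N₁) ℤ.+ + (D + up)
          ≡⟨ cong (ℤ._+ + (D + up)) (toppleWord-∉ G₁ c₁ k∉w) ⟨
        toppleWord G₁ c₁ w k ℤ.+ + (D + up) ∎
        where
        open ≡-Reasoning
        D = k ∸ start (L k)
        up = countᵇ (upperMate k) w
        N₁ = neighbours G₁ k w
        reorder : ∀ a d m u → ((a ℤ.+ d) ℤ.+ + 1) ℤ.+ (m ℤ.+ u) ≡ ((a ℤ.+ + 1) ℤ.+ m) ℤ.+ (d ℤ.+ u)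
        reorder = solve-∀

      independent-agree : ∀ {k w} → Invariant w → CheckedStable k w → InRange G₁ k → k ∉ w →
        clique (L k) ≡ false → Threshold₁ w k ⇔ Threshold₂ w k
      independent-agree {k} {w} inv checked k-inRange k∉w k-indep = mk⇔
        (λ unstable → subst₂ ℤ._≤_ (sym deg≡) (sym load≡) (Equivalence.to shift unstable))
        (λ unstable → Equivalence.from shift (subst₂ ℤ._≤_ deg≡ load≡ unstable))
        where
        deg≡ = cong +_ (deg-Ĝ⊔-independent k-inRange k-indep)
        load≡ = load-independent inv k-inRange k∉w k-indep
        shift = shifted-threshold (+ deg G₁ k) (toppleWord G₁ c₁ w k) (k ∸ start (L k)) _ _ (upperMates-≤ (vertexSet inv))
                  (upper-mates-toppled inv checked k-inRange k∉w k-indep)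

    unstable?-agree : ∀ {k w} → Invariant w → CheckedStable k w → InRange G₁ k →
      unstable? G₁ (toppleWord G₁ c₁ w) k ≡ unstable? G₂ (toppleWord G₂ c₂ w) k
    unstable?-agree {k} {w} inv checked k-inRange =
      Reflects-≡ (unstable?-reflects G₁ (toppleWord G₁ c₁ w) k) (unstable?-reflects G₂ (toppleWord G₂ c₂ w) k)
                 (thresholds-agree (k ∈? w) (clique (L k)) refl)
      where
      thresholds-agree : Dec (k ∈ w) → ∀ b → clique (L k) ≡ b → Threshold₁ w k ⇔ Threshold₂ w k
      thresholds-agree (yes k∈w) _ _ = toppled-agree (vertexSet inv) k-inRange k∈w
      thresholds-agree (no k∉w) true k-clique = clique-agree (vertexSet inv) k-inRange k∉w k-clique
      thresholds-agree (no k∉w) false k-indep = independent-agree inv checked k-inRange k∉w k-indep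

    []-Invariant : Invariant []
    []-Invariant = record { vertexSet = []-VertexSet G₁ ; upClosed = λ _ _ _ _ () }

    CheckedStable-top : ∀ w → CheckedStable n w
    CheckedStable-top w _ (_ , u≤n) _ n<u = ⊥-elim (<-irrefl refl (<-≤-trans n<u u≤n))

    CheckedStable-skip : ∀ {k w} → CheckedStable (suc k) w → toppleWord G₁ c₁ w (suc k) ℤ.< + deg G₁ (suc k) →
      CheckedStable k w
    CheckedStable-skip checked stable-1+k y-inRange u-inRange y≤k k<u mates u∉w with m≤n⇒m<n∨m≡n k<u
    ... | inj₂ refl = stable-1+k
    ... | inj₁ 1+k<u = checked y-inRange u-inRange (m≤n⇒m≤1+n y≤k) 1+k<u mates u∉w

    -- Toppling p = k + 1 keeps upward closure because every untoppled upper mate of p is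
    -- stable, which would make p stable too; afterwards CheckedStable k is vacuous, since a
    -- component reaching below p and above k contains p.
    topple-step : ∀ {k w} → suc k ≤ n → Invariant w → CheckedStable (suc k) w →
      + deg G₁ (suc k) ℤ.≤ toppleWord G₁ c₁ w (suc k) →
      Invariant (w ++ [ suc k ]) × CheckedStable k (w ++ [ suc k ])
    topple-step {k} {w} k<n inv checked unstable = inv′ , checked′
      where
      p = suc k
      p-inRange : InRange G₁ p
      p-inRange = s≤s z≤n , k<n
      p∉w = unstable⇒untoppled G₁ κ stable (vertexSet inv) p-inRange unstable

      upClosed′ : ∀ {x y} → InRange G₁ x → InRange G₁ y → x < y → SameIndependent x y → x ∈ w ++ [ p ] → y ∈ w ++ [ p ]
      upClosed′ x-inRange y-inRange x<y mates x∈ with ∈-++⁻ w x∈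
      ... | inj₁ x∈w = ∈-++⁺ˡ (upClosed inv x-inRange y-inRange x<y mates x∈w)
      ... | inj₂ (here refl) with _ ∈? w
      ...   | yes y∈w = ∈-++⁺ˡ y∈w
      ...   | no y∉w = ⊥-elim (ℤₚ.<⇒≱ (lower-mate-stable (inRange (vertexSet inv)) p-inRange y-inRange x<y mates p∉w y∉w
                                          (checked p-inRange y-inRange ≤-refl x<y mates y∉w)) unstable)

      inv′ : Invariant (w ++ [ p ])
      inv′ = record { vertexSet = VertexSet-∷ʳ (vertexSet inv) p-inRange p∉w ; upClosed = upClosed′ }

      checked′ : CheckedStable k (w ++ [ p ])
      checked′ {y} {u} y-inRange u-inRange y≤k k<u (Ly≡Lu , u-indep) u∉ with m≤n⇒m<n∨m≡n k<u
      ... | inj₂ refl = ⊥-elim (u∉ (∈-++⁺ʳ w (here refl)))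
      ... | inj₁ p<u = ⊥-elim (u∉ (upClosed′ p-inRange u-inRange p<u (Lp≡Lu , u-indep) (∈-++⁺ʳ w (here refl))))
        where
        Lp≡Lu : L p ≡ L u
        Lp≡Lu = locOf-block G₁ u-inRange
          (≤-trans (subst (λ l → start l ≤ y) Ly≡Lu (start≤ y-inRange)) (m≤n⇒m≤1+n y≤k))
          (<-trans p<u (<end u-inRange))

    passWord-agree : ∀ k {w} → k ≤ n → Invariant w → CheckedStable k w →
      passWord G₁ c₁ (map suc (downFrom k)) w ≡ passWord G₂ c₂ (map suc (downFrom k)) w
      × Invariant (passWord G₁ c₁ (map suc (downFrom k)) w)
    passWord-agree zero _ inv _ = refl , inv
    passWord-agree (suc k) {w} k<n inv checked
      with unstable? G₁ (toppleWord G₁ c₁ w) (suc k) | unstable?-reflects G₁ (toppleWord G₁ c₁ w) (suc k)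
         | unstable?-agree inv checked (s≤s z≤n , k<n)
    ... | true | ofʸ unstable | agree rewrite sym agree =
      let inv′ , checked′ = topple-step k<n inv checked unstable in passWord-agree k (<⇒≤ k<n) inv′ checked′
    ... | false | ofⁿ stable-1+k | agree rewrite sym agree =
      passWord-agree k (<⇒≤ k<n) inv (CheckedStable-skip checked (ℤₚ.≰⇒> stable-1+k))

    loopWord-agree : ∀ f {w} → Invariant w → loopWord G₁ c₁ f w ≡ loopWord G₂ c₂ f w × Invariant (loopWord G₁ c₁ f w)
    loopWord-agree zero inv = refl , inv
    loopWord-agree (suc f) {w} inv with allToppled G₁ w
    ... | true = refl , inv
    ... | false rewrite reverse-verts G₁ =
      let pass≡ , inv′ = passWord-agree n ≤-refl inv (CheckedStable-top w)
          loop≡ , inv″ = loopWord-agree f inv′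
      in trans loop≡ (cong (loopWord G₂ c₂ f) pass≡) , inv″

    outputWord-Ĝ⊔ : outputWord G₁ κ ≡ outputWord G₂ κ̃
    outputWord-Ĝ⊔ = trans (outputWord≡loopWord G₁ κ)
      (trans (proj₁ (loopWord-agree n []-Invariant)) (sym (outputWord≡loopWord G₂ κ̃)))

    recurrent-Ĝ⊔ : Recurrent G₁ κ → Recurrent G₂ κ̃
    recurrent-Ĝ⊔ recurrent@(_ , _ , _ , nonNeg , _) =
      tilde-stable κ stable , loopWord G₂ c₂ n [] , word↭ , nonNeg₂ , proj₁ (loopWord-legal G₂ c₂ n (tt , nonNeg₂))
      where
      word↭ : loopWord G₂ c₂ n [] ↭ verts G₂
      word↭ = subst (_↭ verts G₁) (proj₁ (loopWord-agree n []-Invariant)) (loopWord-↭ G₁ κ recurrent)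
      nonNeg₂ : NonNeg G₂ c₂
      nonNeg₂ v v-inRange = ℤₚ.≤-trans (nonNeg v v-inRange) (ℤₚ.+-monoˡ-≤ (+ 1) (tilde-≥ κ v-inRange))

-- The parts of μ and ν need not be positive: an empty component has no vertices.
lemma6p3 : (μ ν : List ℕ) → IsComposition μ → IsComposition ν → (κ : Config) →
    (Sorted (Ĝ μ ν) κ → Stable (Ĝ μ ν) κ →
      Sorted (Ĝ⊔ μ ν) (tilde (Ĝ μ ν) κ) × Stable (Ĝ⊔ μ ν) (tilde (Ĝ μ ν) κ))
    × (Sorted (Ĝ μ ν) κ → Recurrent (Ĝ μ ν) κ →
      Recurrent (Ĝ⊔ μ ν) (tilde (Ĝ μ ν) κ)
      × outputWord (Ĝ μ ν) κ ≡ outputWord (Ĝ⊔ μ ν) (tilde (Ĝ μ ν) κ))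
lemma6p3 μ ν _ _ κ =
  (λ sorted stable → tilde-sorted μ ν κ sorted , tilde-stable μ ν κ stable) ,
  (λ sorted recurrent@(stable , _) →
     recurrent-Ĝ⊔ μ ν κ sorted stable recurrent , outputWord-Ĝ⊔ μ ν κ sorted stable)
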